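{- Let $G$ be an extraspecial group of order $p^r$ ($p$ prime) and let $k\ge1$. Then $\frac{\tilde\rho_k(G)}{|G|^k}=1+(p^{r-1}-1)p^{ -k}$.
   Context: A $p$-group $G$ is extraspecial if $Z(G)=\Phi(G)=[G,G]$ and $|Z(G)|=p$, where $\Phi(G)$ is the intersection of all maximal subgroups. $\tilde\rho_k(G)=\sum_{\vec x\in G^k}|\mathrm{InnStab}(\vec x)|$, where $\mathrm{InnStab}(\vec x)=\{\varphi\in\mathrm{Inn}(G):\varphi(x_i)=x_i\ \forall i\}$ and $\mathrm{Inn}(G)=\{x\mapsto gxg^{ -1}:g\in G\}$. -}

module Defs where

open import Level using (0ℓ)
open import Data.Nat using (ℕ; zero; suc; _^_)
open import Data.Fin using (Fin)
open import Data.Fin.Properties as FinP using (_≟_)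
open import Data.Fin.Subset using (Subset; _∈_; _∉_; _⊆_)
open import Data.List using (List; []; _∷_; map; filter; length; allFin; concatMap; deduplicate)
open import Data.Nat.ListAction using (sum)
open import Data.Vec using (Vec; []; _∷_; tabulate; lookup)
open import Data.Vec.Properties using (≡-dec)
open import Data.Vec.Relation.Unary.All as VAll using (All)
open import Data.Product using (Σ; ∃; _×_; _,_)
open import Data.Sum using (_⊎_)
open import Data.Integer using (+_)
open import Data.Rational using (ℚ; 0ℚ; _/_)
open import Function.Bundles using (_⇔_)
open import Relation.Nullary using (¬_; Dec)
open import Relation.Binary.PropositionalEquality using (_≡_)
open import Algebra.Structures using (IsGroup)

record FinGroup (n : ℕ) : Set where
  infixl 7 _∙_
  field
    _∙_     : Fin n → Fin n → Fin n
    ε       : Fin n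
    _⁻¹     : Fin n → Fin n
    isGroup : IsGroup _≡_ _∙_ ε _⁻¹

module _ {n : ℕ} (G : FinGroup n) where
  open FinGroup G

  IsSubgroup : Subset n → Set
  IsSubgroup S = (ε ∈ S) × (∀ x y → x ∈ S → y ∈ S → (x ∙ y) ∈ S) × (∀ x → x ∈ S → (x ⁻¹) ∈ S)

  IsMaximalSubgroup : Subset n → Set
  IsMaximalSubgroup M = IsSubgroup M × (∃ λ x → x ∉ M)
    × (∀ H → IsSubgroup H → M ⊆ H → (H ⊆ M) ⊎ (∀ x → x ∈ H))

  InFrattini : Fin n → Set
  InFrattini x = ∀ M → IsMaximalSubgroup M → x ∈ M

  InCenter : Fin n → Set
  InCenter x = ∀ y → x ∙ y ≡ y ∙ x

  inCenter? : (x : Fin n) → Dec (InCenter x)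
  inCenter? x = FinP.all? (λ y → (x ∙ y) ≟ (y ∙ x))

  comm : Fin n → Fin n → Fin n
  comm a b = (a ⁻¹) ∙ (b ⁻¹) ∙ a ∙ b

  InDerived : Fin n → Set
  InDerived x = ∀ H → IsSubgroup H → (∀ a b → comm a b ∈ H) → x ∈ H

  centerSize : ℕ
  centerSize = length (filter inCenter? (allFin n))

  IsExtraspecial : ℕ → Set
  IsExtraspecial p = (∀ x → (InCenter x ⇔ InFrattini x))
                   × (∀ x → (InCenter x ⇔ InDerived x))
                   × (centerSize ≡ p)

  conj : Fin n → Vec (Fin n) n
  conj g = tabulate (λ x → g ∙ x ∙ (g ⁻¹))

  -- Inn(G) (as a list, possibly with repetitions)
  innList : List (Vec (Fin n) n)
  innList = map conj (allFin n)

  fixes? : ∀ {k} (xs : Vec (Fin n) k) (φ : Vec (Fin n) n) → Dec (All (λ x → lookup φ x ≡ x) xs)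
  fixes? xs φ = VAll.all? (λ x → lookup φ x ≟ x) xs

  innStabSize : ∀ {k} → Vec (Fin n) k → ℕ
  innStabSize xs = length (deduplicate (≡-dec _≟_) (filter (fixes? xs) innList))

  allTuples : (k : ℕ) → List (Vec (Fin n) k)
  allTuples zero = [] ∷ []
  allTuples (suc k) = concatMap (λ x → map (x ∷_) (allTuples k)) (allFin n)

  rhoTilde : ℕ → ℕ
  rhoTilde k = sum (map innStabSize (allTuples k))

-- a / b in ℚ for naturals (convention: a / 0 = 0; only used with b ≠ 0)
_÷ℕ_ : ℕ → ℕ → ℚ
a ÷ℕ zero = 0ℚ
a ÷ℕ suc b = (+ a) / suc b

-- Counting pairs (x⃗, φ) with φ fixing every xᵢ gives ρ̃ₖ(G) = Σ_{φ ∈ Inn(G)} |Fix φ|ᵏ.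
-- The fibres of g ↦ conj g are the cosets of Z(G), so |Inn(G)| = |G| / p = p^(r-1). For g ∉ Z(G),
-- Fix (conj g) is the centraliser C(g); as commutators are central, x ↦ [g, x] is a homomorphism
-- G → Z(G) with kernel C(g); its image has between 2 and p elements and its size divides p^r, so it
-- has exactly p elements and |C(g)| = p^(r-1). Hence ρ̃ₖ(G) = |G|ᵏ + (p^(r-1) - 1) p^((r-1)k), and
-- dividing by |G|ᵏ = p^((r-1)k) pᵏ gives the formula.
module Submission where

open import Defs
open import Data.Nat using (ℕ; _≥_; _^_; _∸_)

module FiniteCounting where

  open import Level using (Level)
  open import Data.Bool using (true; false; if_then_else_)
  open import Data.Empty using (⊥-elim)
  open import Data.Fin using (Fin; zero; suc)
  open import Data.Fin.Permutation using (Permutation′; _⟨$⟩ʳ_)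
  open import Data.Fin.Properties using (_≟_)
  open import Data.List using (List; []; _∷_; map; filter; length; allFin; concatMap; deduplicate; tabulate; _++_)
  open import Data.List.Properties using (map-++; map-tabulate; length-tabulate; filter-all)
  open import Data.List.Membership.Propositional using (_∈_; _∉_)
  open import Data.List.Membership.Propositional.Properties
    using (∈-map⁺; ∈-map⁻; ∈-deduplicate⁺; ∈-deduplicate⁻; ∈-allFin)
  import Data.List.Membership.DecPropositional as DecMembership
  open import Data.List.Relation.Unary.Any using (here; there)
  open import Data.List.Relation.Unary.All as All using ()
  open import Data.List.Relation.Unary.All.Properties using (all-filter)
  open import Data.List.Relation.Unary.Unique.Propositional using (Unique; _∷_)
  open import Data.List.Relation.Unary.Unique.Propositional.Properties using (allFin⁺)
  open import Data.List.Relation.Unary.Unique.DecPropositional.Properties using (deduplicate-!)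
  open import Data.Nat using (ℕ; zero; suc; _+_; _*_; _≤_; z≤n; s≤s)
  open import Data.Nat.Properties hiding (_≟_)
  open import Data.Nat.ListAction using (sum)
  open import Data.Nat.ListAction.Properties using (sum-++)
  open import Algebra.Properties.CommutativeSemigroup +-commutativeSemigroup
    renaming (interchange to +-interchange; x∙yz≈y∙xz to +-x∙yz≈y∙xz)
  open import Data.Product using (_,_; ∃-syntax)
  open import Function using (_∘_; id)
  open import Function.Bundles using (_⇔_; mk⇔; Equivalence)
  open import Relation.Binary.Definitions using (DecidableEquality)
  open import Relation.Binary.PropositionalEquality
  open import Relation.Nullary using (Dec; yes; no; does; ¬_; ¬?; _×-dec_)
  open import Relation.Unary using (Pred; Decidable)
  import Algebra.Properties.CommutativeMonoid.Sum as CommutativeMonoidSum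

  private variable
    ℓ ℓ′ : Level
    A B : Set
    P : Set ℓ
    Q : Set ℓ′

  𝟙 : Dec P → ℕ
  𝟙 d = if does d then 1 else 0

  𝟙-yes : (d : Dec P) → P → 𝟙 d ≡ 1
  𝟙-yes (yes _) _ = refl
  𝟙-yes (no ¬p) p = ⊥-elim (¬p p)

  𝟙-no : (d : Dec P) → ¬ P → 𝟙 d ≡ 0
  𝟙-no (yes p) ¬p = ⊥-elim (¬p p)
  𝟙-no (no _) _ = refl

  𝟙-⇔ : (d : Dec P) (e : Dec Q) → P ⇔ Q → 𝟙 d ≡ 𝟙 e
  𝟙-⇔ (yes _) (yes _) _ = refl
  𝟙-⇔ (yes p) (no ¬q) P⇔Q = ⊥-elim (¬q (Equivalence.to P⇔Q p))
  𝟙-⇔ (no ¬p) (yes q) P⇔Q = ⊥-elim (¬p (Equivalence.from P⇔Q q))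
  𝟙-⇔ (no _) (no _) _ = refl

  𝟙-×-dec : (d : Dec P) (e : Dec Q) → 𝟙 (d ×-dec e) ≡ 𝟙 d * 𝟙 e
  𝟙-×-dec (yes _) e = sym (+-identityʳ (𝟙 e))
  𝟙-×-dec (no _) _ = refl

  sum-map-cong : {f g : A → ℕ} (xs : List A) → (∀ {x} → x ∈ xs → f x ≡ g x) →
                 sum (map f xs) ≡ sum (map g xs)
  sum-map-cong [] _ = refl
  sum-map-cong (x ∷ xs) f≡g = cong₂ _+_ (f≡g (here refl)) (sum-map-cong xs (f≡g ∘ there))

  sum-map-const : (c : ℕ) (xs : List A) → sum (map (λ _ → c) xs) ≡ length xs * c
  sum-map-const c [] = refl
  sum-map-const c (_ ∷ xs) = cong (c +_) (sum-map-const c xs)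

  sum-map-+ : (f g : A → ℕ) (xs : List A) →
              sum (map (λ x → f x + g x) xs) ≡ sum (map f xs) + sum (map g xs)
  sum-map-+ f g [] = refl
  sum-map-+ f g (x ∷ xs) =
    trans (cong (f x + g x +_) (sum-map-+ f g xs)) (+-interchange (f x) (g x) _ _)

  sum-map-*ˡ : (c : ℕ) (f : A → ℕ) (xs : List A) → sum (map (λ x → c * f x) xs) ≡ c * sum (map f xs)
  sum-map-*ˡ c f [] = sym (*-zeroʳ c)
  sum-map-*ˡ c f (x ∷ xs) =
    trans (cong (c * f x +_) (sum-map-*ˡ c f xs)) (sym (*-distribˡ-+ c (f x) _))

  sum-map-*ʳ : (c : ℕ) (f : A → ℕ) (xs : List A) → sum (map (λ x → f x * c) xs) ≡ sum (map f xs) * c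
  sum-map-*ʳ c f [] = refl
  sum-map-*ʳ c f (x ∷ xs) =
    trans (cong (f x * c +_) (sum-map-*ʳ c f xs)) (sym (*-distribʳ-+ c (f x) _))

  sum-map-mono-≤ : {f g : A → ℕ} (xs : List A) → (∀ x → f x ≤ g x) → sum (map f xs) ≤ sum (map g xs)
  sum-map-mono-≤ [] _ = z≤n
  sum-map-mono-≤ (x ∷ xs) f≤g = +-mono-≤ (f≤g x) (sum-map-mono-≤ xs f≤g)

  sum-map-comm : (f : A → B → ℕ) (xs : List A) (ys : List B) →
                 sum (map (λ x → sum (map (f x) ys)) xs) ≡ sum (map (λ y → sum (map (λ x → f x y) xs)) ys)
  sum-map-comm f [] ys = sym (trans (sum-map-const 0 ys) (*-zeroʳ (length ys)))
  sum-map-comm f (x ∷ xs) ys = trans (cong (sum (map (f x) ys) +_) (sum-map-comm f xs ys))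
    (sym (sum-map-+ (f x) (λ y → sum (map (λ x → f x y) xs)) ys))

  sum-map-concatMap : (h : B → ℕ) (f : A → List B) (xs : List A) →
                      sum (map h (concatMap f xs)) ≡ sum (map (λ x → sum (map h (f x))) xs)
  sum-map-concatMap h f [] = refl
  sum-map-concatMap h f (x ∷ xs) = begin
    sum (map h (f x ++ concatMap f xs))                          ≡⟨ cong sum (map-++ h (f x) _) ⟩
    sum (map h (f x) ++ map h (concatMap f xs))                  ≡⟨ sum-++ (map h (f x)) _ ⟩
    sum (map h (f x)) + sum (map h (concatMap f xs))             ≡⟨ cong (sum (map h (f x)) +_) (sum-map-concatMap h f xs) ⟩
    sum (map h (f x)) + sum (map (λ x → sum (map h (f x))) xs)   ∎
    where open ≡-Reasoning

  length-filter≡sum-𝟙 : {P : Pred A ℓ} (P? : Decidable P) (xs : List A) →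
                        length (filter P? xs) ≡ sum (map (𝟙 ∘ P?) xs)
  length-filter≡sum-𝟙 P? [] = refl
  length-filter≡sum-𝟙 P? (x ∷ xs) with does (P? x)
  ... | true  = cong suc (length-filter≡sum-𝟙 P? xs)
  ... | false = length-filter≡sum-𝟙 P? xs

  filter-comm : {P : Pred A ℓ} {Q : Pred A ℓ′} (P? : Decidable P) (Q? : Decidable Q) (xs : List A) →
                filter P? (filter Q? xs) ≡ filter Q? (filter P? xs)
  filter-comm P? Q? [] = refl
  filter-comm P? Q? (x ∷ xs) with does (P? x) in P[x] | does (Q? x) in Q[x]
  ... | true  | true  rewrite P[x] | Q[x] = cong (x ∷_) (filter-comm P? Q? xs)
  ... | true  | false rewrite Q[x]        = filter-comm P? Q? xs
  ... | false | true  rewrite P[x]        = filter-comm P? Q? xs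
  ... | false | false                     = filter-comm P? Q? xs

  deduplicate-filter : (_≟ᴬ_ : DecidableEquality A) {P : Pred A ℓ} (P? : Decidable P) (xs : List A) →
                       deduplicate _≟ᴬ_ (filter P? xs) ≡ filter P? (deduplicate _≟ᴬ_ xs)
  deduplicate-filter _≟ᴬ_ P? [] = refl
  deduplicate-filter {A = A} _≟ᴬ_ {P} P? (x ∷ xs) with P? x
  ... | yes _ = cong (x ∷_) (trans (cong (filter x≢?) (deduplicate-filter _≟ᴬ_ P? xs))
                                   (filter-comm x≢? P? (deduplicate _≟ᴬ_ xs)))
    where
    x≢? : Decidable (λ y → ¬ x ≡ y)
    x≢? = ¬? ∘ (x ≟ᴬ_)
  ... | no ¬P[x] = begin
    deduplicate _≟ᴬ_ (filter P? xs)                ≡⟨ deduplicate-filter _≟ᴬ_ P? xs ⟩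
    filter P? ys                                   ≡⟨ filter-all x≢? (All.map x≢ (all-filter P? ys)) ⟨
    filter x≢? (filter P? ys)                      ≡⟨ filter-comm x≢? P? ys ⟩
    filter P? (filter x≢? ys)                      ∎
    where
    open ≡-Reasoning
    ys : List A
    ys = deduplicate _≟ᴬ_ xs
    x≢? : Decidable (λ y → ¬ x ≡ y)
    x≢? = ¬? ∘ (x ≟ᴬ_)
    x≢ : ∀ {y} → P y → ¬ x ≡ y
    x≢ P[y] refl = ¬P[x] P[y]

  distinct-∈⇒2≤length : {x y : A} (xs : List A) → x ∈ xs → y ∈ xs → x ≢ y → 2 ≤ length xs
  distinct-∈⇒2≤length (_ ∷ _ ∷ _) _ _ _ = s≤s (s≤s z≤n)
  distinct-∈⇒2≤length (_ ∷ []) (here refl) (here refl) x≢y = ⊥-elim (x≢y refl)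

  module _ (_≟ᴬ_ : DecidableEquality A) where

    𝟙-≟-comm : ∀ x y → 𝟙 (x ≟ᴬ y) ≡ 𝟙 (y ≟ᴬ x)
    𝟙-≟-comm x y = 𝟙-⇔ (x ≟ᴬ y) (y ≟ᴬ x) (mk⇔ sym sym)

    multiplicity : A → List A → ℕ
    multiplicity x xs = sum (map (λ y → 𝟙 (x ≟ᴬ y)) xs)

    multiplicity-∉ : ∀ {x} xs → x ∉ xs → multiplicity x xs ≡ 0
    multiplicity-∉ [] _ = refl
    multiplicity-∉ {x} (y ∷ xs) x∉ = cong₂ _+_ (𝟙-no (x ≟ᴬ y) (x∉ ∘ here)) (multiplicity-∉ xs (x∉ ∘ there))

    multiplicity-unique-∈ : ∀ {x} xs → Unique xs → x ∈ xs → multiplicity x xs ≡ 1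
    multiplicity-unique-∈ {x} (x ∷ xs) (x∉xs ∷ _) (here refl) =
      cong₂ _+_ (𝟙-yes (x ≟ᴬ x) refl) (multiplicity-∉ xs λ x∈xs → All.lookup x∉xs x∈xs refl)
    multiplicity-unique-∈ {x} (y ∷ xs) (y∉xs ∷ !xs) (there x∈xs) =
      cong₂ _+_ (𝟙-no (x ≟ᴬ y) λ { refl → All.lookup y∉xs x∈xs refl }) (multiplicity-unique-∈ xs !xs x∈xs)

    sum-map-unique-except : (f : A → ℕ) (b : ℕ) {e : A} (xs : List A) → Unique xs → e ∈ xs →
                            (∀ {x} → x ∈ xs → x ≢ e → f x ≡ b) → sum (map f xs) + b ≡ f e + length xs * b
    sum-map-unique-except f b {e} (e ∷ xs) (e∉xs ∷ _) (here refl) f≡b = begin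
      f e + sum (map f xs) + b          ≡⟨ cong (λ s → f e + s + b) (sum-map-cong xs others) ⟩
      f e + sum (map (λ _ → b) xs) + b  ≡⟨ cong (λ s → f e + s + b) (sum-map-const b xs) ⟩
      f e + length xs * b + b           ≡⟨ +-assoc (f e) _ b ⟩
      f e + (length xs * b + b)         ≡⟨ cong (f e +_) (+-comm _ b) ⟩
      f e + (b + length xs * b)         ∎
      where
      open ≡-Reasoning
      others : ∀ {x} → x ∈ xs → f x ≡ b
      others x∈xs = f≡b (there x∈xs) λ { refl → All.lookup e∉xs x∈xs refl }
    sum-map-unique-except f b {e} (x ∷ xs) (x∉xs ∷ !xs) (there e∈xs) f≡b = begin
      f x + sum (map f xs) + b        ≡⟨ cong (λ a → a + sum (map f xs) + b) (f≡b (here refl) x≢e) ⟩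
      b + sum (map f xs) + b          ≡⟨ +-assoc b _ b ⟩
      b + (sum (map f xs) + b)        ≡⟨ cong (b +_) (sum-map-unique-except f b xs !xs e∈xs (f≡b ∘ there)) ⟩
      b + (f e + length xs * b)       ≡⟨ +-x∙yz≈y∙xz b (f e) _ ⟩
      f e + (b + length xs * b)       ∎
      where
      open ≡-Reasoning
      x≢e : x ≢ e
      x≢e refl = All.lookup x∉xs e∈xs refl

  module ∑ = CommutativeMonoidSum +-0-commutativeMonoid

  sum-map-allFin≡∑ : ∀ {n} (h : Fin n → ℕ) → sum (map h (allFin n)) ≡ ∑.sum h
  sum-map-allFin≡∑ {zero} h = refl
  sum-map-allFin≡∑ {suc n} h = cong (h zero +_) (begin
    sum (map h (tabulate suc))          ≡⟨ cong sum (map-tabulate suc h) ⟩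
    sum (tabulate (h ∘ suc))            ≡⟨ cong sum (map-tabulate id (h ∘ suc)) ⟨
    sum (map (h ∘ suc) (allFin n))      ≡⟨ sum-map-allFin≡∑ (h ∘ suc) ⟩
    ∑.sum (h ∘ suc)                     ∎)
    where open ≡-Reasoning

  module _ {n : ℕ} where

    length-unique≤count : {P : Pred (Fin n) ℓ} (P? : Decidable P) (xs : List (Fin n)) →
                          Unique xs → (∀ {x} → x ∈ xs → P x) → length xs ≤ sum (map (𝟙 ∘ P?) (allFin n))
    length-unique≤count P? xs !xs P[xs] = begin
      length xs                                                    ≡⟨ trans (sum-map-const 1 xs) (*-identityʳ _) ⟨
      sum (map (λ _ → 1) xs)                                       ≡⟨ sum-map-cong xs (λ {x} _ → sym (once x)) ⟩
      sum (map (λ x → multiplicity _≟_ x (allFin n)) xs)           ≡⟨ sum-map-comm (λ x y → 𝟙 (x ≟ y)) xs (allFin n) ⟩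
      sum (map (λ y → sum (map (λ x → 𝟙 (x ≟ y)) xs)) (allFin n)) ≤⟨ sum-map-mono-≤ (allFin n) atMostP ⟩
      sum (map (𝟙 ∘ P?) (allFin n))                                ∎
      where
      open ≤-Reasoning
      open DecMembership _≟_ using (_∈?_)
      once : ∀ x → multiplicity _≟_ x (allFin n) ≡ 1
      once x = multiplicity-unique-∈ _≟_ (allFin n) (allFin⁺ n) (∈-allFin x)
      multiplicity≤𝟙 : ∀ y → multiplicity _≟_ y xs ≤ 𝟙 (P? y)
      multiplicity≤𝟙 y with y ∈? xs
      ... | yes y∈xs = ≤-reflexive (trans (multiplicity-unique-∈ _≟_ xs !xs y∈xs) (sym (𝟙-yes (P? y) (P[xs] y∈xs))))
      ... | no  y∉xs = subst (_≤ 𝟙 (P? y)) (sym (multiplicity-∉ _≟_ xs y∉xs)) z≤n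
      atMostP : ∀ y → sum (map (λ x → 𝟙 (x ≟ y)) xs) ≤ 𝟙 (P? y)
      atMostP y = ≤-trans (≤-reflexive (sum-map-cong xs λ {x} _ → 𝟙-≟-comm _≟_ x y)) (multiplicity≤𝟙 y)

    sum-map-1-allFin : sum (map (λ _ → 1) (allFin n)) ≡ n
    sum-map-1-allFin = trans (sum-map-const 1 (allFin n)) (trans (*-identityʳ _) (length-tabulate id))

    sum-map-allFin-permute : (h : Fin n → ℕ) (π : Permutation′ n) →
                             sum (map h (allFin n)) ≡ sum (map (h ∘ (π ⟨$⟩ʳ_)) (allFin n))
    sum-map-allFin-permute h π = begin
      sum (map h (allFin n))               ≡⟨ sum-map-allFin≡∑ h ⟩
      ∑.sum h                              ≡⟨ ∑.sum-permute h π ⟩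
      ∑.sum (h ∘ (π ⟨$⟩ʳ_))                ≡⟨ sum-map-allFin≡∑ (h ∘ (π ⟨$⟩ʳ_)) ⟨
      sum (map (h ∘ (π ⟨$⟩ʳ_)) (allFin n)) ∎
      where open ≡-Reasoning

    module _ {B : Set} (_≟ᴮ_ : DecidableEquality B) (f : Fin n → B) where

      image : List B
      image = deduplicate _≟ᴮ_ (map f (allFin n))

      fibreSize : B → ℕ
      fibreSize b = sum (map (λ y → 𝟙 (f y ≟ᴮ b)) (allFin n))

      ∈-image : ∀ x → f x ∈ image
      ∈-image x = ∈-deduplicate⁺ _≟ᴮ_ (∈-map⁺ f (∈-allFin x))

      image-⊆ : ∀ {b} → b ∈ image → ∃[ x ] b ≡ f x
      image-⊆ b∈ with ∈-map⁻ f (∈-deduplicate⁻ _≟ᴮ_ _ b∈)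
      ... | x , _ , b≡fx = x , b≡fx

      n≡|image|*fibreSize : ∀ {c} → (∀ x → fibreSize (f x) ≡ c) → n ≡ length image * c
      n≡|image|*fibreSize {c} fibres≡c = begin
        n                                                            ≡⟨ sum-map-1-allFin ⟨
        sum (map (λ _ → 1) (allFin n))                               ≡⟨ sum-map-cong (allFin n) (λ {y} _ → sym (once y)) ⟩
        sum (map (λ y → multiplicity _≟ᴮ_ (f y) image) (allFin n))   ≡⟨ sum-map-comm 𝟙[f≟] (allFin n) image ⟩
        sum (map fibreSize image)                                    ≡⟨ sum-map-cong image fibre≡c ⟩
        sum (map (λ _ → c) image)                                    ≡⟨ sum-map-const c image ⟩
        length image * c                                             ∎
        where
        open ≡-Reasoning
        𝟙[f≟] : Fin n → B → ℕ
        𝟙[f≟] y b = 𝟙 (f y ≟ᴮ b)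
        once : ∀ y → multiplicity _≟ᴮ_ (f y) image ≡ 1
        once y = multiplicity-unique-∈ _≟ᴮ_ image (deduplicate-! _≟ᴮ_ _) (∈-image y)
        fibre≡c : ∀ {b} → b ∈ image → fibreSize b ≡ c
        fibre≡c b∈ with image-⊆ b∈
        ... | x , refl = fibres≡c x

module PrimePowers where

  open import Data.Empty using (⊥-elim)
  open import Data.Nat using (zero; suc; _*_; _^_; _∸_; _≤_; _<_; _≤?_)
  open import Data.Nat.Properties
  open import Data.Nat.Coprimality using (Coprime; coprime-divisor; prime⇒coprime)
  import Data.Nat.Coprimality as Coprime
  open import Data.Nat.Divisibility using (_∣_; ∣1⇒≡1)
  open import Data.Nat.Primality using (Prime; prime⇒nonZero; ¬prime[1])
  open import Algebra.Properties.CommutativeSemigroup *-commutativeSemigroup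
    renaming (interchange to *-interchange)
  open import Relation.Binary.PropositionalEquality
  open import Relation.Nullary using (yes; no)

  ^-distribʳ-* : ∀ m n k → (m * n) ^ k ≡ m ^ k * n ^ k
  ^-distribʳ-* m n zero = refl
  ^-distribʳ-* m n (suc k) =
    trans (cong (m * n *_) (^-distribʳ-* m n k)) (*-interchange m n (m ^ k) (n ^ k))

  coprime∧∣^⇒≡1 : ∀ {d p} r → Coprime d p → d ∣ p ^ r → d ≡ 1
  coprime∧∣^⇒≡1 zero _ d∣1 = ∣1⇒≡1 d∣1
  coprime∧∣^⇒≡1 (suc r) d⊥p d∣p^r = coprime∧∣^⇒≡1 r d⊥p (coprime-divisor d⊥p d∣p^r)

  1<d∣p^r⇒p≤d : ∀ {d p} r → Prime p → d ∣ p ^ r → 1 < d → p ≤ d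
  1<d∣p^r⇒p≤d {suc d} {p} r pr d∣p^r 1<d with p ≤? suc d
  ... | yes p≤d = p≤d
  ... | no  p≰d = ⊥-elim (<⇒≢ 1<d (sym d≡1))
    where
    d≡1 : suc d ≡ 1
    d≡1 = coprime∧∣^⇒≡1 r (Coprime.sym (prime⇒coprime pr (≰⇒> p≰d))) d∣p^r

  m*p≡p^r⇒m≡p^[r∸1] : ∀ {m p} r → Prime p → m * p ≡ p ^ r → m ≡ p ^ (r ∸ 1)
  m*p≡p^r⇒m≡p^[r∸1] {m} {p} zero pr m*p≡1 = ⊥-elim (¬prime[1] (subst Prime (m*n≡1⇒n≡1 m p m*p≡1) pr))
  m*p≡p^r⇒m≡p^[r∸1] {m} {p} (suc r) pr m*p≡p^r =
    *-cancelʳ-≡ m (p ^ r) p {{prime⇒nonZero pr}} (trans m*p≡p^r (*-comm p (p ^ r)))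

module RationalArithmetic where

  open import Defs using (_÷ℕ_)
  open import Data.Nat as ℕ using (suc; _<_)
  import Data.Nat.Properties as ℕ
  open import Data.Integer as ℤ using (+_)
  import Data.Integer.Properties as ℤ
  open import Data.Rational using (ℚ; 1ℚ; _+_; _-_; _*_; toℚᵘ)
  open import Data.Rational.Properties
    using (toℚᵘ-injective; toℚᵘ-homo-+; toℚᵘ-homo-*; toℚᵘ-fromℚᵘ; *-identityʳ)
  import Data.Rational.Unnormalised as ℚᵘ
  import Data.Rational.Unnormalised.Properties as ℚᵘ
  open import Data.Rational.Solver using (module +-*-Solver)
  open import Relation.Binary.PropositionalEquality

  toℚᵘ-÷ℕ : ∀ x d → toℚᵘ (x ÷ℕ suc d) ℚᵘ.≃ ℚᵘ.mkℚᵘ (+ x) d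
  toℚᵘ-÷ℕ x d = toℚᵘ-fromℚᵘ (ℚᵘ.mkℚᵘ (+ x) d)

  ÷ℕ1-homo-+ : ∀ x y → (x ℕ.+ y) ÷ℕ 1 ≡ x ÷ℕ 1 + y ÷ℕ 1
  ÷ℕ1-homo-+ x y = toℚᵘ-injective (begin
    toℚᵘ ((x ℕ.+ y) ÷ℕ 1)                 ≈⟨ toℚᵘ-÷ℕ (x ℕ.+ y) 0 ⟩
    ℚᵘ.mkℚᵘ (+ (x ℕ.+ y)) 0                ≈⟨ ℚᵘ.*≡* cross ⟩
    ℚᵘ.mkℚᵘ (+ x) 0 ℚᵘ.+ ℚᵘ.mkℚᵘ (+ y) 0  ≈⟨ ℚᵘ.+-cong (toℚᵘ-÷ℕ x 0) (toℚᵘ-÷ℕ y 0) ⟨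
    toℚᵘ (x ÷ℕ 1) ℚᵘ.+ toℚᵘ (y ÷ℕ 1)      ≈⟨ toℚᵘ-homo-+ (x ÷ℕ 1) (y ÷ℕ 1) ⟨
    toℚᵘ (x ÷ℕ 1 + y ÷ℕ 1)                ∎)
    where
    open ℚᵘ.≃-Reasoning
    cross : + (x ℕ.+ y) ℤ.* + 1 ≡ (+ x ℤ.* + 1 ℤ.+ + y ℤ.* + 1) ℤ.* + 1
    cross = trans (ℤ.*-identityʳ _) (trans (ℤ.pos-+ x y) (sym (trans (ℤ.*-identityʳ _)
              (cong₂ ℤ._+_ (ℤ.*-identityʳ (+ x)) (ℤ.*-identityʳ (+ y))))))

  ÷ℕ1-homo-* : ∀ x y → (x ℕ.* y) ÷ℕ 1 ≡ x ÷ℕ 1 * y ÷ℕ 1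
  ÷ℕ1-homo-* x y = toℚᵘ-injective (begin
    toℚᵘ ((x ℕ.* y) ÷ℕ 1)                 ≈⟨ toℚᵘ-÷ℕ (x ℕ.* y) 0 ⟩
    ℚᵘ.mkℚᵘ (+ (x ℕ.* y)) 0                ≈⟨ ℚᵘ.*≡* cross ⟩
    ℚᵘ.mkℚᵘ (+ x) 0 ℚᵘ.* ℚᵘ.mkℚᵘ (+ y) 0  ≈⟨ ℚᵘ.*-cong (toℚᵘ-÷ℕ x 0) (toℚᵘ-÷ℕ y 0) ⟨
    toℚᵘ (x ÷ℕ 1) ℚᵘ.* toℚᵘ (y ÷ℕ 1)      ≈⟨ toℚᵘ-homo-* (x ÷ℕ 1) (y ÷ℕ 1) ⟨
    toℚᵘ (x ÷ℕ 1 * y ÷ℕ 1)                ∎)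
    where
    open ℚᵘ.≃-Reasoning
    cross : + (x ℕ.* y) ℤ.* + 1 ≡ (+ x ℤ.* + y) ℤ.* + 1
    cross = trans (ℤ.*-identityʳ _) (trans (ℤ.pos-* x y) (sym (ℤ.*-identityʳ _)))

  ÷ℕ-*-denominator : ∀ x d → (x ÷ℕ suc d) * (suc d ÷ℕ 1) ≡ x ÷ℕ 1
  ÷ℕ-*-denominator x d = toℚᵘ-injective (begin
    toℚᵘ ((x ÷ℕ suc d) * (suc d ÷ℕ 1))              ≈⟨ toℚᵘ-homo-* (x ÷ℕ suc d) (suc d ÷ℕ 1) ⟩
    toℚᵘ (x ÷ℕ suc d) ℚᵘ.* toℚᵘ (suc d ÷ℕ 1)       ≈⟨ ℚᵘ.*-cong (toℚᵘ-÷ℕ x d) (toℚᵘ-÷ℕ (suc d) 0) ⟩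
    ℚᵘ.mkℚᵘ (+ x) d ℚᵘ.* ℚᵘ.mkℚᵘ (+ suc d) 0       ≈⟨ ℚᵘ.*≡* cross ⟩
    ℚᵘ.mkℚᵘ (+ x) 0                                 ≈⟨ toℚᵘ-÷ℕ x 0 ⟨
    toℚᵘ (x ÷ℕ 1)                                   ∎)
    where
    open ℚᵘ.≃-Reasoning
    cross : (+ x ℤ.* + suc d) ℤ.* + 1 ≡ + x ℤ.* + (suc d ℕ.* 1)
    cross = trans (ℤ.*-identityʳ _) (cong (λ z → + x ℤ.* + z) (sym (ℕ.*-identityʳ (suc d))))

  *-cancelʳ-÷ℕ1 : ∀ u v d → u * (suc d ÷ℕ 1) ≡ v * (suc d ÷ℕ 1) → u ≡ v
  *-cancelʳ-÷ℕ1 u v d uD≡vD = begin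
    u                ≡⟨ *-identityʳ u ⟨
    u * 1ℚ           ≡⟨ cong (u *_) D⁻¹D≡1 ⟨
    u * (D⁻¹ * D)    ≡⟨ solve 3 (λ u D D⁻¹ → u :* (D⁻¹ :* D) := (u :* D) :* D⁻¹) refl u D D⁻¹ ⟩
    (u * D) * D⁻¹    ≡⟨ cong (_* D⁻¹) uD≡vD ⟩
    (v * D) * D⁻¹    ≡⟨ solve 3 (λ v D D⁻¹ → (v :* D) :* D⁻¹ := v :* (D⁻¹ :* D)) refl v D D⁻¹ ⟩
    v * (D⁻¹ * D)    ≡⟨ cong (v *_) D⁻¹D≡1 ⟩
    v * 1ℚ           ≡⟨ *-identityʳ v ⟩
    v                ∎
    where
    open ≡-Reasoning
    open +-*-Solver
    D D⁻¹ : ℚ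
    D = suc d ÷ℕ 1
    D⁻¹ = 1 ÷ℕ suc d
    D⁻¹D≡1 : D⁻¹ * D ≡ 1ℚ
    D⁻¹D≡1 = ÷ℕ-*-denominator 1 d

  -- The hypothesis says ρ = K q + (m - 1) K, written without truncated subtraction.
  ÷ℕ-from-affine : ∀ ρ m {K q} → 0 < K → 0 < q → ρ ℕ.+ K ≡ K ℕ.* q ℕ.+ m ℕ.* K →
                   ρ ÷ℕ (K ℕ.* q) ≡ 1ℚ + (m ÷ℕ 1 - 1ℚ) * (1 ÷ℕ q)
  ÷ℕ-from-affine ρ m {suc a} {suc b} _ _ ρ+K≡Kq+mK = *-cancelʳ-÷ℕ1 _ _ (b ℕ.+ a ℕ.* suc b) (begin
    (ρ ÷ℕ (suc a ℕ.* suc b)) * N     ≡⟨ ÷ℕ-*-denominator ρ _ ⟩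
    R                                 ≡⟨ solve 2 (λ R K → R := (R :+ K) :- K) refl R K ⟩
    (R + K) - K                       ≡⟨ cong (_- K) R+K≡KQ+MK ⟩
    (K * Q + M * K) - K               ≡⟨ regroup ⟩
    K * Q + (M - 1ℚ) * K * 1ℚ         ≡⟨ cong (λ z → K * Q + (M - 1ℚ) * K * z) (÷ℕ-*-denominator 1 b) ⟨
    K * Q + (M - 1ℚ) * K * (t * Q)    ≡⟨ factor ⟩
    (1ℚ + (M - 1ℚ) * t) * (K * Q)     ≡⟨ cong ((1ℚ + (M - 1ℚ) * t) *_) (÷ℕ1-homo-* (suc a) (suc b)) ⟨
    (1ℚ + (M - 1ℚ) * t) * N           ∎)
    where
    open ≡-Reasoning
    open +-*-Solver
    R M K Q N t : ℚ
    R = ρ ÷ℕ 1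
    M = m ÷ℕ 1
    K = suc a ÷ℕ 1
    Q = suc b ÷ℕ 1
    N = (suc a ℕ.* suc b) ÷ℕ 1
    t = 1 ÷ℕ suc b
    R+K≡KQ+MK : R + K ≡ K * Q + M * K
    R+K≡KQ+MK = begin
      R + K                                   ≡⟨ ÷ℕ1-homo-+ ρ (suc a) ⟨
      (ρ ℕ.+ suc a) ÷ℕ 1                      ≡⟨ cong (_÷ℕ 1) ρ+K≡Kq+mK ⟩
      (suc a ℕ.* suc b ℕ.+ m ℕ.* suc a) ÷ℕ 1  ≡⟨ ÷ℕ1-homo-+ (suc a ℕ.* suc b) (m ℕ.* suc a) ⟩
      N + (m ℕ.* suc a) ÷ℕ 1                  ≡⟨ cong₂ _+_ (÷ℕ1-homo-* (suc a) (suc b)) (÷ℕ1-homo-* m (suc a)) ⟩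
      K * Q + M * K                           ∎
    regroup : (K * Q + M * K) - K ≡ K * Q + (M - 1ℚ) * K * 1ℚ
    regroup = solve 3 (λ M K Q → (K :* Q :+ M :* K) :- K := K :* Q :+ (M :- con 1ℚ) :* K :* con 1ℚ) refl M K Q
    factor : K * Q + (M - 1ℚ) * K * (t * Q) ≡ (1ℚ + (M - 1ℚ) * t) * (K * Q)
    factor = solve 4 (λ M K Q t → K :* Q :+ (M :- con 1ℚ) :* K :* (t :* Q) := (con 1ℚ :+ (M :- con 1ℚ) :* t) :* (K :* Q))
                   refl M K Q t

module CommutatorCalculus {n : ℕ} (G : FinGroup n) where

  open import Algebra.Bundles using (Group)
  open import Algebra.Structures using (IsGroup)
  open import Data.Fin using (Fin)
  open import Data.Vec using (lookup)
  open import Data.Vec.Properties using (lookup∘tabulate; tabulate-cong)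
  open import Function.Bundles using (_⇔_; mk⇔; Equivalence)
  import Function.Properties.Equivalence as ⇔
  open import Level using (0ℓ)
  open import Relation.Binary.PropositionalEquality

  open FinGroup G
  open IsGroup isGroup using (assoc; identityˡ; inverseˡ)

  group : Group 0ℓ 0ℓ
  group = record { Carrier = Fin n ; _≈_ = _≡_ ; _∙_ = _∙_ ; ε = ε ; _⁻¹ = _⁻¹ ; isGroup = isGroup }

  open import Algebra.Properties.Group group
    using ( ⁻¹-anti-homo-∙; ⁻¹-injective; inverseˡ-unique; ∙-cancelˡ; ∙-cancelʳ
          ; \\-leftDividesˡ; //-rightDividesˡ; //-rightDividesʳ)

  conjugate : Fin n → Fin n → Fin n
  conjugate g x = g ∙ x ∙ g ⁻¹

  lookup-conj : ∀ g x → lookup (conj G g) x ≡ conjugate g x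
  lookup-conj g = lookup∘tabulate (conjugate g)

  conjugate-injective : ∀ g {x y} → conjugate g x ≡ conjugate g y → x ≡ y
  conjugate-injective g gxg⁻¹≡gyg⁻¹ = ∙-cancelˡ g _ _ (∙-cancelʳ (g ⁻¹) _ _ gxg⁻¹≡gyg⁻¹)

  conjugate-∙ : ∀ g h x → conjugate (g ∙ h) x ≡ conjugate g (conjugate h x)
  conjugate-∙ g h x = begin
    ((g ∙ h) ∙ x) ∙ (g ∙ h) ⁻¹      ≡⟨ cong (((g ∙ h) ∙ x) ∙_) (⁻¹-anti-homo-∙ g h) ⟩
    ((g ∙ h) ∙ x) ∙ (h ⁻¹ ∙ g ⁻¹)   ≡⟨ assoc _ (h ⁻¹) (g ⁻¹) ⟨
    (((g ∙ h) ∙ x) ∙ h ⁻¹) ∙ g ⁻¹   ≡⟨ cong (λ y → (y ∙ h ⁻¹) ∙ g ⁻¹) (assoc g h x) ⟩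
    ((g ∙ (h ∙ x)) ∙ h ⁻¹) ∙ g ⁻¹   ≡⟨ cong (_∙ g ⁻¹) (assoc g (h ∙ x) (h ⁻¹)) ⟩
    (g ∙ ((h ∙ x) ∙ h ⁻¹)) ∙ g ⁻¹   ∎
    where open ≡-Reasoning

  conjugate-fixes⇔commute : ∀ g x → conjugate g x ≡ x ⇔ g ∙ x ≡ x ∙ g
  conjugate-fixes⇔commute g x = mk⇔
    (λ gxg⁻¹≡x → trans (sym (//-rightDividesˡ g (g ∙ x))) (cong (_∙ g) gxg⁻¹≡x))
    (λ gx≡xg → trans (cong (_∙ g ⁻¹) gx≡xg) (//-rightDividesʳ g x))

  conj-fixes⇔commute : ∀ g x → lookup (conj G g) x ≡ x ⇔ g ∙ x ≡ x ∙ g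
  conj-fixes⇔commute g x = ⇔.trans (mk⇔ (trans (sym (lookup-conj g x))) (trans (lookup-conj g x)))
                                   (conjugate-fixes⇔commute g x)

  conj-∙≡conj⇔central : ∀ g z → conj G (g ∙ z) ≡ conj G g ⇔ InCenter G z
  conj-∙≡conj⇔central g z = mk⇔ z-central conj-∙≡conj
    where
    z-central : conj G (g ∙ z) ≡ conj G g → InCenter G z
    z-central conj≡ x = Equivalence.to (conjugate-fixes⇔commute z x) (conjugate-injective g (begin
      conjugate g (conjugate z x)  ≡⟨ conjugate-∙ g z x ⟨
      conjugate (g ∙ z) x          ≡⟨ lookup-conj (g ∙ z) x ⟨
      lookup (conj G (g ∙ z)) x    ≡⟨ cong (λ φ → lookup φ x) conj≡ ⟩
      lookup (conj G g) x          ≡⟨ lookup-conj g x ⟩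
      conjugate g x                ∎))
      where open ≡-Reasoning
    conj-∙≡conj : InCenter G z → conj G (g ∙ z) ≡ conj G g
    conj-∙≡conj z-central = tabulate-cong λ x →
      trans (conjugate-∙ g z x) (cong (conjugate g) (Equivalence.from (conjugate-fixes⇔commute z x) (z-central x)))

  comm≡[ba]⁻¹ab : ∀ a b → comm G a b ≡ (b ∙ a) ⁻¹ ∙ (a ∙ b)
  comm≡[ba]⁻¹ab a b = trans (assoc (a ⁻¹ ∙ b ⁻¹) a b) (cong (_∙ (a ∙ b)) (sym (⁻¹-anti-homo-∙ b a)))

  ab≡ba[a,b] : ∀ a b → a ∙ b ≡ (b ∙ a) ∙ comm G a b
  ab≡ba[a,b] a b = sym (trans (cong ((b ∙ a) ∙_) (comm≡[ba]⁻¹ab a b)) (\\-leftDividesˡ (b ∙ a) (a ∙ b)))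

  comm≡ε⇔commute : ∀ a b → comm G a b ≡ ε ⇔ a ∙ b ≡ b ∙ a
  comm≡ε⇔commute a b = mk⇔
    (λ [a,b]≡ε → sym (⁻¹-injective (inverseˡ-unique ((b ∙ a) ⁻¹) (a ∙ b)
                                      (trans (sym (comm≡[ba]⁻¹ab a b)) [a,b]≡ε))))
    (λ ab≡ba → trans (comm≡[ba]⁻¹ab a b) (trans (cong ((b ∙ a) ⁻¹ ∙_) ab≡ba) (inverseˡ (b ∙ a))))

  CommutatorsCentral : Set
  CommutatorsCentral = ∀ a b → InCenter G (comm G a b)

  module _ (central : CommutatorsCentral) where

    comm-∙ʳ : ∀ g x y → comm G g (x ∙ y) ≡ comm G g x ∙ comm G g y
    comm-∙ʳ g x y = trans (∙-cancelˡ ((x ∙ y) ∙ g) _ _ (trans (sym (ab≡ba[a,b] g (x ∙ y))) expand))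
                          (central g y [g,x])
      where
      open ≡-Reasoning
      [g,x] [g,y] : Fin n
      [g,x] = comm G g x
      [g,y] = comm G g y
      expand : g ∙ (x ∙ y) ≡ ((x ∙ y) ∙ g) ∙ ([g,y] ∙ [g,x])
      expand = begin
        g ∙ (x ∙ y)                    ≡⟨ assoc g x y ⟨
        (g ∙ x) ∙ y                    ≡⟨ cong (_∙ y) (ab≡ba[a,b] g x) ⟩
        ((x ∙ g) ∙ [g,x]) ∙ y          ≡⟨ assoc (x ∙ g) [g,x] y ⟩
        (x ∙ g) ∙ ([g,x] ∙ y)          ≡⟨ cong ((x ∙ g) ∙_) (central g x y) ⟩
        (x ∙ g) ∙ (y ∙ [g,x])          ≡⟨ assoc (x ∙ g) y [g,x] ⟨
        ((x ∙ g) ∙ y) ∙ [g,x]          ≡⟨ cong (_∙ [g,x]) (assoc x g y) ⟩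
        (x ∙ (g ∙ y)) ∙ [g,x]          ≡⟨ cong (λ z → (x ∙ z) ∙ [g,x]) (ab≡ba[a,b] g y) ⟩
        (x ∙ ((y ∙ g) ∙ [g,y])) ∙ [g,x] ≡⟨ cong (_∙ [g,x]) (assoc x (y ∙ g) [g,y]) ⟨
        ((x ∙ (y ∙ g)) ∙ [g,y]) ∙ [g,x] ≡⟨ cong (λ z → (z ∙ [g,y]) ∙ [g,x]) (assoc x y g) ⟨
        (((x ∙ y) ∙ g) ∙ [g,y]) ∙ [g,x] ≡⟨ assoc ((x ∙ y) ∙ g) [g,y] [g,x] ⟩
        ((x ∙ y) ∙ g) ∙ ([g,y] ∙ [g,x]) ∎

    comm-∙ˡ-fibre⇔commute : ∀ g x z → comm G g (z ∙ x) ≡ comm G g x ⇔ g ∙ z ≡ z ∙ g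
    comm-∙ˡ-fibre⇔commute g x z = mk⇔
      (λ fibre → Equivalence.to (comm≡ε⇔commute g z)
                   (∙-cancelʳ (comm G g x) _ _ (trans (sym (comm-∙ʳ g z x)) (trans fibre (sym (identityˡ _))))))
      (λ gz≡zg → trans (comm-∙ʳ g z x)
                   (trans (cong (_∙ comm G g x) (Equivalence.from (comm≡ε⇔commute g z) gz≡zg)) (identityˡ _)))

module InnerAutomorphismCounting {n : ℕ} (G : FinGroup n) where

  open import Algebra.Structures using (IsGroup)
  open import Data.Fin using (Fin)
  open import Data.Fin.Properties using (_≟_; ¬∀⟶∃¬)
  open import Data.Fin.Permutation using (Permutation′; permutation)
  open import Data.List using (List; map; length; allFin)
  open import Data.List.Properties using (map-∘)
  open import Data.List.Membership.Propositional using (_∈_)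
  open import Data.List.Relation.Unary.Unique.DecPropositional.Properties using (deduplicate-!)
  open import Data.Nat using (ℕ; zero; suc; _+_; _*_; _^_; _∸_; _≤_)
  open import Data.Nat.Properties hiding (_≟_)
  open import Data.Nat.Divisibility using (_∣_; m∣m*n)
  open import Data.Nat.ListAction using (sum)
  open import Data.Nat.Primality using (Prime; prime⇒nonZero)
  open import Data.Product using (_,_; proj₁; proj₂)
  open import Data.Vec using (Vec; lookup; _∷_)
  open import Data.Vec.Properties using (≡-dec)
  open import Function using (_∘_)
  open import Function.Bundles using (Equivalence)
  import Function.Properties.Equivalence as ⇔
  open import Relation.Binary.Definitions using (DecidableEquality)
  open import Relation.Binary.PropositionalEquality
  open import Relation.Nullary using (¬_; _×-dec_)

  open FiniteCounting
  open PrimePowers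
  open CommutatorCalculus G
  open FinGroup G
  open IsGroup isGroup using (identityˡ; identityʳ)
  open import Algebra.Properties.Group group using (\\-leftDividesˡ; \\-leftDividesʳ; //-rightDividesˡ; //-rightDividesʳ)

  _≟ᵛ_ : DecidableEquality (Vec (Fin n) n)
  _≟ᵛ_ = ≡-dec _≟_

  fixCount : Vec (Fin n) n → ℕ
  fixCount φ = sum (map (λ x → 𝟙 (lookup φ x ≟ x)) (allFin n))

  Inn : List (Vec (Fin n) n)
  Inn = image _≟ᵛ_ (conj G)

  count-fixed-tuples : ∀ φ k → sum (map (λ xs → 𝟙 (fixes? G xs φ)) (allTuples G k)) ≡ fixCount φ ^ k
  count-fixed-tuples φ zero = refl
  count-fixed-tuples φ (suc k) = begin
    sum (map 𝟙fixes (allTuples G (suc k)))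
      ≡⟨ sum-map-concatMap 𝟙fixes _ (allFin n) ⟩
    sum (map (λ x → sum (map 𝟙fixes (map (x ∷_) (allTuples G k)))) (allFin n))
      ≡⟨ sum-map-cong (allFin n) (λ {x} _ → prepend x) ⟩
    sum (map (λ x → 𝟙fixed x * fixCount φ ^ k) (allFin n))
      ≡⟨ sum-map-*ʳ (fixCount φ ^ k) 𝟙fixed (allFin n) ⟩
    fixCount φ * fixCount φ ^ k
      ∎
    where
    open ≡-Reasoning
    𝟙fixed : Fin n → ℕ
    𝟙fixed x = 𝟙 (lookup φ x ≟ x)
    𝟙fixes : ∀ {m} → Vec (Fin n) m → ℕ
    𝟙fixes xs = 𝟙 (fixes? G xs φ)
    prepend : ∀ x → sum (map 𝟙fixes (map (x ∷_) (allTuples G k))) ≡ 𝟙fixed x * fixCount φ ^ k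
    prepend x = begin
      sum (map 𝟙fixes (map (x ∷_) (allTuples G k)))
        ≡⟨ cong sum (map-∘ (allTuples G k)) ⟨
      sum (map (λ xs → 𝟙 (lookup φ x ≟ x ×-dec fixes? G xs φ)) (allTuples G k))
        ≡⟨ sum-map-cong (allTuples G k) (λ {xs} _ → 𝟙-×-dec (lookup φ x ≟ x) (fixes? G xs φ)) ⟩
      sum (map (λ xs → 𝟙fixed x * 𝟙fixes xs) (allTuples G k))
        ≡⟨ sum-map-*ˡ (𝟙fixed x) 𝟙fixes (allTuples G k) ⟩
      𝟙fixed x * sum (map 𝟙fixes (allTuples G k))
        ≡⟨ cong (𝟙fixed x *_) (count-fixed-tuples φ k) ⟩
      𝟙fixed x * fixCount φ ^ k
        ∎

  rhoTilde≡∑fixCount^k : ∀ k → rhoTilde G k ≡ sum (map (λ φ → fixCount φ ^ k) Inn)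
  rhoTilde≡∑fixCount^k k = begin
    sum (map (innStabSize G) (allTuples G k))
      ≡⟨ sum-map-cong (allTuples G k) (λ {xs} _ → innStabSize≡ xs) ⟩
    sum (map (λ xs → sum (map (𝟙 ∘ fixes? G xs) Inn)) (allTuples G k))
      ≡⟨ sum-map-comm (λ xs φ → 𝟙 (fixes? G xs φ)) (allTuples G k) Inn ⟩
    sum (map (λ φ → sum (map (λ xs → 𝟙 (fixes? G xs φ)) (allTuples G k))) Inn)
      ≡⟨ sum-map-cong Inn (λ {φ} _ → count-fixed-tuples φ k) ⟩
    sum (map (λ φ → fixCount φ ^ k) Inn)
      ∎
    where
    open ≡-Reasoning
    innStabSize≡ : ∀ xs → innStabSize G xs ≡ sum (map (𝟙 ∘ fixes? G xs) Inn)
    innStabSize≡ xs = trans (cong length (deduplicate-filter _≟ᵛ_ (fixes? G xs) (innList G)))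
                            (length-filter≡sum-𝟙 (fixes? G xs) Inn)

  centerSize≡count : centerSize G ≡ sum (map (𝟙 ∘ inCenter? G) (allFin n))
  centerSize≡count = length-filter≡sum-𝟙 (inCenter? G) (allFin n)

  left-translation : Fin n → Permutation′ n
  left-translation g = permutation (g ∙_) (g ⁻¹ ∙_) (\\-leftDividesˡ g) (\\-leftDividesʳ g)

  right-translation : Fin n → Permutation′ n
  right-translation g = permutation (_∙ g) (_∙ g ⁻¹) (λ x → //-rightDividesˡ g x) (λ x → //-rightDividesʳ g x)

  -- The fibre of g ↦ conj g through conj x is the coset x Z(G).
  fibreSize-conj : ∀ x → fibreSize _≟ᵛ_ (conj G) (conj G x) ≡ centerSize G
  fibreSize-conj x = begin
    sum (map (λ y → 𝟙 (conj G y ≟ᵛ conj G x)) (allFin n))       ≡⟨ sum-map-allFin-permute _ (left-translation x) ⟩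
    sum (map (λ z → 𝟙 (conj G (x ∙ z) ≟ᵛ conj G x)) (allFin n)) ≡⟨ sum-map-cong (allFin n) (λ {z} _ → central z) ⟩
    sum (map (𝟙 ∘ inCenter? G) (allFin n))                      ≡⟨ centerSize≡count ⟨
    centerSize G                                                ∎
    where
    open ≡-Reasoning
    central : ∀ z → 𝟙 (conj G (x ∙ z) ≟ᵛ conj G x) ≡ 𝟙 (inCenter? G z)
    central z = 𝟙-⇔ (conj G (x ∙ z) ≟ᵛ conj G x) (inCenter? G z) (conj-∙≡conj⇔central x z)

  n≡|Inn|*|Z| : n ≡ length Inn * centerSize G
  n≡|Inn|*|Z| = n≡|image|*fibreSize _≟ᵛ_ (conj G) fibreSize-conj

  fixCount-conj-ε : fixCount (conj G ε) ≡ n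
  fixCount-conj-ε = trans (sum-map-cong (allFin n) (λ {x} _ → 𝟙-yes (lookup (conj G ε) x ≟ x) (ε-fixes x)))
                          sum-map-1-allFin
    where
    ε-fixes : ∀ x → lookup (conj G ε) x ≡ x
    ε-fixes x = Equivalence.from (conj-fixes⇔commute ε x) (trans (identityˡ x) (sym (identityʳ x)))

  -- c ^ k is added on both sides so that the identity automorphism is split off without truncated subtraction.
  rhoTilde-uniform : ∀ {c} → (∀ g → ¬ InCenter G g → fixCount (conj G g) ≡ c) →
                     ∀ k → rhoTilde G k + c ^ k ≡ n ^ k + length Inn * c ^ k
  rhoTilde-uniform {c} noncentral≡c k = begin
    rhoTilde G k + c ^ k                           ≡⟨ cong (_+ c ^ k) (rhoTilde≡∑fixCount^k k) ⟩
    sum (map (λ φ → fixCount φ ^ k) Inn) + c ^ k   ≡⟨ sum-map-unique-except _≟ᵛ_ _ (c ^ k) Inn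
                                                        (deduplicate-! _≟ᵛ_ _) (∈-image _≟ᵛ_ (conj G) ε) others ⟩
    fixCount (conj G ε) ^ k + length Inn * c ^ k   ≡⟨ cong (λ m → m ^ k + length Inn * c ^ k) fixCount-conj-ε ⟩
    n ^ k + length Inn * c ^ k                     ∎
    where
    open ≡-Reasoning
    others : ∀ {φ} → φ ∈ Inn → φ ≢ conj G ε → fixCount φ ^ k ≡ c ^ k
    others φ∈Inn φ≢id with image-⊆ _≟ᵛ_ (conj G) φ∈Inn
    ... | g , refl = cong (_^ k) (noncentral≡c g λ g-central →
          φ≢id (trans (cong (conj G) (sym (identityˡ g))) (Equivalence.from (conj-∙≡conj⇔central ε g) g-central)))

  module _ (central : CommutatorsCentral) where

    commutatorsWith : Fin n → List (Fin n)
    commutatorsWith g = image _≟_ (comm G g)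

    -- The fibre of x ↦ [g, x] through [g, x] is the coset C(g) x.
    fibreSize-comm : ∀ g x → fibreSize _≟_ (comm G g) (comm G g x) ≡ fixCount (conj G g)
    fibreSize-comm g x = trans (sum-map-allFin-permute _ (right-translation x))
      (sum-map-cong (allFin n) λ {z} _ → 𝟙-⇔ (comm G g (z ∙ x) ≟ comm G g x) (lookup (conj G g) z ≟ z)
        (⇔.trans (comm-∙ˡ-fibre⇔commute central g x z) (⇔.sym (conj-fixes⇔commute g z))))

    n≡|[g,G]|*fixCount : ∀ g → n ≡ length (commutatorsWith g) * fixCount (conj G g)
    n≡|[g,G]|*fixCount g = n≡|image|*fibreSize _≟_ (comm G g) (fibreSize-comm g)

    |[g,G]|≤|Z| : ∀ g → length (commutatorsWith g) ≤ centerSize G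
    |[g,G]|≤|Z| g = ≤-trans (length-unique≤count (inCenter? G) (commutatorsWith g) (deduplicate-! _≟_ _) in-center)
                            (≤-reflexive (sym centerSize≡count))
      where
      in-center : ∀ {z} → z ∈ commutatorsWith g → InCenter G z
      in-center z∈ with image-⊆ _≟_ (comm G g) z∈
      ... | y , refl = central g y

    2≤|[g,G]| : ∀ g → ¬ InCenter G g → 2 ≤ length (commutatorsWith g)
    2≤|[g,G]| g g-noncentral with ¬∀⟶∃¬ n (λ y → g ∙ y ≡ y ∙ g) (λ y → (g ∙ y) ≟ (y ∙ g)) g-noncentral
    ... | y , gy≢yg =
      distinct-∈⇒2≤length (commutatorsWith g) (∈-image _≟_ (comm G g) ε) (∈-image _≟_ (comm G g) y) [g,ε]≢[g,y]
      where
      [g,ε]≡ε : comm G g ε ≡ ε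
      [g,ε]≡ε = Equivalence.from (comm≡ε⇔commute g ε) (trans (identityʳ g) (sym (identityˡ g)))
      [g,ε]≢[g,y] : comm G g ε ≢ comm G g y
      [g,ε]≢[g,y] [g,ε]≡[g,y] = gy≢yg (Equivalence.to (comm≡ε⇔commute g y) (trans (sym [g,ε]≡[g,y]) [g,ε]≡ε))

    -- |[g, G]| divides |G| = p^r and lies in [2, p], so it is p, and then |C(g)| = |G| / p = |Inn(G)|.
    fixCount-noncentral : ∀ {p} r → Prime p → n ≡ p ^ r → centerSize G ≡ p →
                          ∀ g → ¬ InCenter G g → fixCount (conj G g) ≡ length Inn
    fixCount-noncentral {p} r pr n≡p^r |Z|≡p g g-noncentral =
      *-cancelˡ-≡ (fixCount (conj G g)) (length Inn) p {{prime⇒nonZero pr}} (begin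
        p * fixCount (conj G g)                           ≡⟨ cong (_* fixCount (conj G g)) |[g,G]|≡p ⟨
        length (commutatorsWith g) * fixCount (conj G g)  ≡⟨ n≡|[g,G]|*fixCount g ⟨
        n                                                 ≡⟨ n≡|Inn|*|Z| ⟩
        length Inn * centerSize G                         ≡⟨ cong (length Inn *_) |Z|≡p ⟩
        length Inn * p                                    ≡⟨ *-comm (length Inn) p ⟩
        p * length Inn                                    ∎)
      where
      open ≡-Reasoning
      |[g,G]|∣p^r : length (commutatorsWith g) ∣ p ^ r
      |[g,G]|∣p^r = subst (_ ∣_) (trans (sym (n≡|[g,G]|*fixCount g)) n≡p^r) (m∣m*n _)
      |[g,G]|≡p : length (commutatorsWith g) ≡ p
      |[g,G]|≡p = ≤-antisym (≤-trans (|[g,G]|≤|Z| g) (≤-reflexive |Z|≡p))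
                            (1<d∣p^r⇒p≤d r pr |[g,G]|∣p^r (2≤|[g,G]| g g-noncentral))

  module _ {p : ℕ} (r : ℕ) (pr : Prime p) (n≡p^r : n ≡ p ^ r) (extraspecial : IsExtraspecial G p) where

    commutators-central : CommutatorsCentral
    commutators-central a b = Equivalence.from (proj₁ (proj₂ extraspecial) (comm G a b)) λ _ _ comms∈H → comms∈H a b

    |Z|≡p : centerSize G ≡ p
    |Z|≡p = proj₂ (proj₂ extraspecial)

    n≡|Inn|*p : n ≡ length Inn * p
    n≡|Inn|*p = trans n≡|Inn|*|Z| (cong (length Inn *_) |Z|≡p)

    |Inn|≡p^[r∸1] : length Inn ≡ p ^ (r ∸ 1)
    |Inn|≡p^[r∸1] = m*p≡p^r⇒m≡p^[r∸1] r pr (trans (sym n≡|Inn|*p) n≡p^r)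

    n^k≡p^[r∸1]^k*p^k : ∀ k → n ^ k ≡ (p ^ (r ∸ 1)) ^ k * p ^ k
    n^k≡p^[r∸1]^k*p^k k = trans (cong (_^ k) (trans n≡|Inn|*p (cong (_* p) |Inn|≡p^[r∸1]))) (^-distribʳ-* _ p k)

    rhoTilde-extraspecial : ∀ k → let m = p ^ (r ∸ 1) in rhoTilde G k + m ^ k ≡ m ^ k * p ^ k + m * m ^ k
    rhoTilde-extraspecial k = begin
      rhoTilde G k + m ^ k                   ≡⟨ cong (λ c → rhoTilde G k + c ^ k) |Inn|≡p^[r∸1] ⟨
      rhoTilde G k + length Inn ^ k          ≡⟨ rhoTilde-uniform fixCount≡|Inn| k ⟩
      n ^ k + length Inn * length Inn ^ k    ≡⟨ cong₂ (λ N c → N + c * c ^ k) (n^k≡p^[r∸1]^k*p^k k) |Inn|≡p^[r∸1] ⟩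
      m ^ k * p ^ k + m * m ^ k              ∎
      where
      open ≡-Reasoning
      m : ℕ
      m = p ^ (r ∸ 1)
      fixCount≡|Inn| : ∀ g → ¬ InCenter G g → fixCount (conj G g) ≡ length Inn
      fixCount≡|Inn| = fixCount-noncentral commutators-central r pr n≡p^r |Z|≡p

open import Data.Nat using (NonZero)
open import Data.Nat.Properties using (m^n>0; m^n≢0)
open import Data.Nat.Primality using (Prime; prime⇒nonZero)
open import Data.Rational using (1ℚ; _+_; _-_; _*_)
open import Relation.Binary.PropositionalEquality using (_≡_; cong; trans)
open RationalArithmetic using (÷ℕ-from-affine)
open InnerAutomorphismCounting using (n^k≡p^[r∸1]^k*p^k; rhoTilde-extraspecial)

corollary5p21 : (p r n : ℕ) → Prime p → n ≡ p ^ r → (G : FinGroup n) → IsExtraspecial G p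
    → (k : ℕ) → k ≥ 1
    → rhoTilde G k ÷ℕ (n ^ k) ≡ 1ℚ + ((p ^ (r ∸ 1)) ÷ℕ 1 - 1ℚ) * (1 ÷ℕ (p ^ k))
corollary5p21 p r n pr n≡p^r G ex k _ =
  trans (cong (rhoTilde G k ÷ℕ_) (n^k≡p^[r∸1]^k*p^k G r pr n≡p^r ex k))
        (÷ℕ-from-affine (rhoTilde G k) (p ^ (r ∸ 1)) (m^n>0 (p ^ (r ∸ 1)) k) (m^n>0 p k)
          (rhoTilde-extraspecial G r pr n≡p^r ex k))
  where
  instance
    p≢0 : NonZero p
    p≢0 = prime⇒nonZero pr
    p^[r∸1]≢0 : NonZero (p ^ (r ∸ 1))
    p^[r∸1]≢0 = m^n≢0 p (r ∸ 1)
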